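{- Let $F:\mathcal{A}\to\mathcal{C}$ and $G:\mathcal{B}\to\mathcal{C}$ be functors, $\mathcal{G}=(F\downarrow G)$. Assume $\mathcal{A}$ is regular and $F$ is faithful and has a right adjoint $F^{\star}$ with counit $\theta:FF^{\star}\to\mathrm{id}_{\mathcal{C}}$. For $(A,f,B)$ in $\mathcal{G}$ let $\hat f:A\to F^{\star}G(B)$ be the unique morphism with $\theta_{G(B)}\circ F(\hat f)=f$, let $\hat f=m_{\hat f}\circ e_{\hat f}$ be an image factorization ($e_{\hat f}:A\to\mathrm{Ran}(\hat f)$ regular epi, $m_{\hat f}$ mono), and let $\eta_{(A,f,B)}=(e_{\hat f},\mathrm{id}_B):(A,f,B)\to(\mathrm{Ran}(\hat f),\theta_{G(B)}\circ F(m_{\hat f}),B)$. If $(A,f,B)$ is simple, then $\eta_{(A,f,B)}$ is an isomorphism in $\mathcal{G}$.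
   Context: The comma category $(F\downarrow G)$ has objects $(A,f,B)$ with $f:F(A)\to G(B)$ in $\mathcal{C}$, and morphisms $(\phi,\psi):(A,f,B)\to(A',f',B')$ with $\phi:A\to A'$, $\psi:B\to B'$ and $f'\circ F(\phi)=G(\psi)\circ f$. An object $(A,f,B)$ is simple if $f$ is a monomorphism in $\mathcal{C}$. -}

module Defs where

open import Level using (Level; _⊔_; suc)
open import Data.Product using (Σ; Σ-syntax; _×_; _,_; proj₁; proj₂)
open import Relation.Binary using (Rel; IsEquivalence; Setoid)
import Relation.Binary.Reasoning.Setoid as SetoidR

record Category (o ℓ e : Level) : Set (suc (o ⊔ ℓ ⊔ e)) where
  infixr 9 _∘_
  infix  4 _≈_
  infixr 5 _⇒_
  field
    Obj       : Set o
    _⇒_       : Obj → Obj → Set ℓ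
    _≈_       : ∀ {A B} → Rel (A ⇒ B) e
    id        : ∀ {A} → A ⇒ A
    _∘_       : ∀ {A B C} → B ⇒ C → A ⇒ B → A ⇒ C
    equiv     : ∀ {A B} → IsEquivalence (_≈_ {A} {B})
    assoc     : ∀ {A B C D} {f : A ⇒ B} {g : B ⇒ C} {h : C ⇒ D} →
                (h ∘ g) ∘ f ≈ h ∘ (g ∘ f)
    identityˡ : ∀ {A B} {f : A ⇒ B} → id ∘ f ≈ f
    identityʳ : ∀ {A B} {f : A ⇒ B} → f ∘ id ≈ f
    ∘-resp-≈  : ∀ {A B C} {f h : B ⇒ C} {g i : A ⇒ B} →
                f ≈ h → g ≈ i → f ∘ g ≈ h ∘ i

  hom-setoid : Obj → Obj → Setoid ℓ e
  hom-setoid A B = record { Carrier = A ⇒ B ; _≈_ = _≈_ ; isEquivalence = equiv }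

  module Eq {A B : Obj} = IsEquivalence (equiv {A} {B})

  Mono : ∀ {A B} → A ⇒ B → Set (o ⊔ ℓ ⊔ e)
  Mono {A} f = ∀ {X} (g h : X ⇒ A) → f ∘ g ≈ f ∘ h → g ≈ h

  record Iso {A B : Obj} (f : A ⇒ B) : Set (ℓ ⊔ e) where
    field
      inv    : B ⇒ A
      isoˡ   : inv ∘ f ≈ id
      isoʳ   : f ∘ inv ≈ id

  record IsCoequalizer {X Y Q : Obj} (f g : X ⇒ Y) (q : Y ⇒ Q) : Set (o ⊔ ℓ ⊔ e) where
    field
      equality   : q ∘ f ≈ q ∘ g
      universal  : ∀ {Z} (h : Y ⇒ Z) → h ∘ f ≈ h ∘ g →
                   Σ[ u ∈ Q ⇒ Z ] ((u ∘ q ≈ h) × (∀ (v : Q ⇒ Z) → v ∘ q ≈ h → v ≈ u))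

  RegularEpi : ∀ {Y Q} → Y ⇒ Q → Set (o ⊔ ℓ ⊔ e)
  RegularEpi {Y} q = Σ[ X ∈ Obj ] Σ[ f ∈ X ⇒ Y ] Σ[ g ∈ X ⇒ Y ] IsCoequalizer f g q

  record IsPullback {X Y Z P : Obj} (f : X ⇒ Z) (g : Y ⇒ Z)
                    (p₁ : P ⇒ X) (p₂ : P ⇒ Y) : Set (o ⊔ ℓ ⊔ e) where
    field
      commute   : f ∘ p₁ ≈ g ∘ p₂
      universal : ∀ {W} (h₁ : W ⇒ X) (h₂ : W ⇒ Y) → f ∘ h₁ ≈ g ∘ h₂ →
                  Σ[ u ∈ W ⇒ P ] ((p₁ ∘ u ≈ h₁) × (p₂ ∘ u ≈ h₂) ×
                     (∀ (v : W ⇒ P) → p₁ ∘ v ≈ h₁ → p₂ ∘ v ≈ h₂ → v ≈ u))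

  record IsTerminal (T : Obj) : Set (o ⊔ ℓ ⊔ e) where
    field
      ! : ∀ {A} → A ⇒ T
      !-unique : ∀ {A} (f : A ⇒ T) → f ≈ !

  record IsRegular : Set (o ⊔ ℓ ⊔ e) where
    field
      terminal  : Σ[ T ∈ Obj ] IsTerminal T
      pullback  : ∀ {X Y Z} (f : X ⇒ Z) (g : Y ⇒ Z) →
                  Σ[ P ∈ Obj ] Σ[ p₁ ∈ P ⇒ X ] Σ[ p₂ ∈ P ⇒ Y ] IsPullback f g p₁ p₂
      kernelPair-coeq : ∀ {X Z P} (f : X ⇒ Z) (p₁ p₂ : P ⇒ X) → IsPullback f f p₁ p₂ →
                  Σ[ Q ∈ Obj ] Σ[ q ∈ X ⇒ Q ] IsCoequalizer p₁ p₂ q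
      regularEpi-stable : ∀ {X Y Z P} (f : X ⇒ Z) (g : Y ⇒ Z)
                  (p₁ : P ⇒ X) (p₂ : P ⇒ Y) → IsPullback f g p₁ p₂ →
                  RegularEpi g → RegularEpi p₁

record Functor {o ℓ e o′ ℓ′ e′ : Level}
               (𝒞 : Category o ℓ e) (𝒟 : Category o′ ℓ′ e′)
               : Set (o ⊔ ℓ ⊔ e ⊔ o′ ⊔ ℓ′ ⊔ e′) where
  private
    module C = Category 𝒞
    module D = Category 𝒟
  field
    F₀           : C.Obj → D.Obj
    F₁           : ∀ {A B} → A C.⇒ B → F₀ A D.⇒ F₀ B
    identity     : ∀ {A} → F₁ (C.id {A}) D.≈ D.id
    homomorphism : ∀ {X Y Z} {f : X C.⇒ Y} {g : Y C.⇒ Z} →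
                   F₁ (g C.∘ f) D.≈ F₁ g D.∘ F₁ f
    F-resp-≈     : ∀ {A B} {f g : A C.⇒ B} → f C.≈ g → F₁ f D.≈ F₁ g

Faithful : ∀ {o ℓ e o′ ℓ′ e′} {𝒞 : Category o ℓ e} {𝒟 : Category o′ ℓ′ e′} →
           Functor 𝒞 𝒟 → Set (o ⊔ ℓ ⊔ e ⊔ e′)
Faithful {𝒞 = 𝒞} {𝒟} F =
  ∀ {A B} (f g : A C.⇒ B) → F₁ f D.≈ F₁ g → f C.≈ g
  where
    module C = Category 𝒞
    module D = Category 𝒟
    open Functor F

record RightAdjoint {oa ℓa ea oc ℓc ec : Level}
                    {𝒜 : Category oa ℓa ea} {𝒞 : Category oc ℓc ec}
                    (F : Functor 𝒜 𝒞) : Set (oa ⊔ ℓa ⊔ ea ⊔ oc ⊔ ℓc ⊔ ec) where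
  private
    module A = Category 𝒜
    module C = Category 𝒞
    module F = Functor F
  field
    F⋆       : Functor 𝒞 𝒜
  private
    module R = Functor F⋆
  field
    θ        : ∀ X → F.F₀ (R.F₀ X) C.⇒ X
    θ-natural : ∀ {X Y} (h : X C.⇒ Y) → θ Y C.∘ F.F₁ (R.F₁ h) C.≈ h C.∘ θ X
    hat      : ∀ {A X} → F.F₀ A C.⇒ X → A A.⇒ R.F₀ X
    hat-commute : ∀ {A X} (f : F.F₀ A C.⇒ X) → θ X C.∘ F.F₁ (hat f) C.≈ f
    hat-unique  : ∀ {A X} (f : F.F₀ A C.⇒ X) (g : A A.⇒ R.F₀ X) →
                  θ X C.∘ F.F₁ g C.≈ f → g A.≈ hat f

module _ {oa ℓa ea ob ℓb eb oc ℓc ec : Level}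
         {𝒜 : Category oa ℓa ea} {ℬ : Category ob ℓb eb} {𝒞 : Category oc ℓc ec}
         (F : Functor 𝒜 𝒞) (G : Functor ℬ 𝒞) where
  private
    module A = Category 𝒜
    module B = Category ℬ
    module C = Category 𝒞
    module F = Functor F
    module G = Functor G

  record CommaObj : Set (oa ⊔ ob ⊔ ℓc) where
    constructor commaObj
    field
      src : A.Obj
      tgt : B.Obj
      arr : F.F₀ src C.⇒ G.F₀ tgt

  open CommaObj

  record CommaHom (X Y : CommaObj) : Set (ℓa ⊔ ℓb ⊔ ec) where
    constructor commaHom
    field
      φ       : src X A.⇒ src Y
      ψ       : tgt X B.⇒ tgt Y
      commute : arr Y C.∘ F.F₁ φ C.≈ G.F₁ ψ C.∘ arr X

  open CommaHom

  private
    compHom : ∀ {X Y Z} → CommaHom Y Z → CommaHom X Y → CommaHom X Z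
    compHom {X} {Y} {Z} (commaHom φ₂ ψ₂ c₂) (commaHom φ₁ ψ₁ c₁) =
      commaHom (φ₂ A.∘ φ₁) (ψ₂ B.∘ ψ₁) (begin
        arr Z C.∘ F.F₁ (φ₂ A.∘ φ₁)         ≈⟨ C.∘-resp-≈ C.Eq.refl F.homomorphism ⟩
        arr Z C.∘ (F.F₁ φ₂ C.∘ F.F₁ φ₁)    ≈⟨ C.Eq.sym C.assoc ⟩
        (arr Z C.∘ F.F₁ φ₂) C.∘ F.F₁ φ₁    ≈⟨ C.∘-resp-≈ c₂ C.Eq.refl ⟩
        (G.F₁ ψ₂ C.∘ arr Y) C.∘ F.F₁ φ₁    ≈⟨ C.assoc ⟩
        G.F₁ ψ₂ C.∘ (arr Y C.∘ F.F₁ φ₁)    ≈⟨ C.∘-resp-≈ C.Eq.refl c₁ ⟩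
        G.F₁ ψ₂ C.∘ (G.F₁ ψ₁ C.∘ arr X)    ≈⟨ C.Eq.sym C.assoc ⟩
        (G.F₁ ψ₂ C.∘ G.F₁ ψ₁) C.∘ arr X    ≈⟨ C.∘-resp-≈ (C.Eq.sym G.homomorphism) C.Eq.refl ⟩
        G.F₁ (ψ₂ B.∘ ψ₁) C.∘ arr X         ∎)
      where open SetoidR (C.hom-setoid _ _)

    idHom : ∀ {X} → CommaHom X X
    idHom {X} = commaHom A.id B.id (begin
        arr X C.∘ F.F₁ A.id    ≈⟨ C.∘-resp-≈ C.Eq.refl F.identity ⟩
        arr X C.∘ C.id         ≈⟨ C.identityʳ ⟩
        arr X                  ≈⟨ C.Eq.sym C.identityˡ ⟩
        C.id C.∘ arr X         ≈⟨ C.∘-resp-≈ (C.Eq.sym G.identity) C.Eq.refl ⟩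
        G.F₁ B.id C.∘ arr X    ∎)
      where open SetoidR (C.hom-setoid _ _)

  Comma : Category (oa ⊔ ob ⊔ ℓc) (ℓa ⊔ ℓb ⊔ ec) (ea ⊔ eb)
  Comma = record
    { Obj = CommaObj
    ; _⇒_ = CommaHom
    ; _≈_ = λ h k → (φ h A.≈ φ k) × (ψ h B.≈ ψ k)
    ; id = idHom
    ; _∘_ = compHom
    ; equiv = record
      { refl  = A.Eq.refl , B.Eq.refl
      ; sym   = λ (p , q) → A.Eq.sym p , B.Eq.sym q
      ; trans = λ (p , q) (p′ , q′) → A.Eq.trans p p′ , B.Eq.trans q q′ }
    ; assoc = A.assoc , B.assoc
    ; identityˡ = A.identityˡ , B.identityˡ
    ; identityʳ = A.identityʳ , B.identityʳ
    ; ∘-resp-≈ = λ (p , q) (p′ , q′) → A.∘-resp-≈ p p′ , B.∘-resp-≈ q q′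
    }

  Simple : CommaObj → Set (oc ⊔ ℓc ⊔ ec)
  Simple X = C.Mono (arr X)

  module _ (adj : RightAdjoint F) where
    private
      module Adj = RightAdjoint adj
      module R = Functor Adj.F⋆

    hatArr : (X : CommaObj) → src X A.⇒ R.F₀ (G.F₀ (tgt X))
    hatArr X = Adj.hat (arr X)

    etaTarget : (X : CommaObj) {Ran : A.Obj} (m : Ran A.⇒ R.F₀ (G.F₀ (tgt X))) → CommaObj
    etaTarget X {Ran} m = commaObj Ran (tgt X) (Adj.θ (G.F₀ (tgt X)) C.∘ F.F₁ m)

    eta : (X : CommaObj) {Ran : A.Obj} (e : src X A.⇒ Ran)
          (m : Ran A.⇒ R.F₀ (G.F₀ (tgt X))) → m A.∘ e A.≈ hatArr X →
          CommaHom X (etaTarget X m)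
    eta X e m fac = commaHom e B.id (begin
        (θ C.∘ F.F₁ m) C.∘ F.F₁ e   ≈⟨ C.assoc ⟩
        θ C.∘ (F.F₁ m C.∘ F.F₁ e)   ≈⟨ C.∘-resp-≈ C.Eq.refl (C.Eq.sym F.homomorphism) ⟩
        θ C.∘ F.F₁ (m A.∘ e)        ≈⟨ C.∘-resp-≈ C.Eq.refl (F.F-resp-≈ fac) ⟩
        θ C.∘ F.F₁ (hatArr X)       ≈⟨ Adj.hat-commute (arr X) ⟩
        arr X                       ≈⟨ C.Eq.sym C.identityˡ ⟩
        C.id C.∘ arr X              ≈⟨ C.∘-resp-≈ (C.Eq.sym G.identity) C.Eq.refl ⟩
        G.F₁ B.id C.∘ arr X         ∎)
      where
        open SetoidR (C.hom-setoid _ _)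
        θ = Adj.θ (G.F₀ (tgt X))

-- Since θ ∘ F m ∘ F e = f is monic, so is F e; a faithful functor reflects
-- monos, so e is a monic regular epimorphism and therefore invertible.  As the
-- second component of η is the identity, η is invertible in the comma category.
module Submission where

open import Defs
open import Level using (Level)
open import Data.Product using (_,_; proj₁; proj₂)
import Relation.Binary.Reasoning.Setoid as SetoidR

module _ {o ℓ e} (𝒞 : Category o ℓ e) where
  open Category 𝒞

  Mono-cancelʳ : ∀ {A B C} (g : B ⇒ C) (f : A ⇒ B) → Mono (g ∘ f) → Mono f
  Mono-cancelʳ g f g∘f-mono h k f∘h≈f∘k = g∘f-mono h k (begin
    (g ∘ f) ∘ h  ≈⟨ assoc ⟩
    g ∘ (f ∘ h)  ≈⟨ ∘-resp-≈ Eq.refl f∘h≈f∘k ⟩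
    g ∘ (f ∘ k)  ≈⟨ Eq.sym assoc ⟩
    (g ∘ f) ∘ k  ∎)
    where open SetoidR (hom-setoid _ _)

  Mono-resp-≈ : ∀ {A B} {f g : A ⇒ B} → f ≈ g → Mono f → Mono g
  Mono-resp-≈ f≈g f-mono h k g∘h≈g∘k =
    f-mono h k (Eq.trans (∘-resp-≈ f≈g Eq.refl) (Eq.trans g∘h≈g∘k (∘-resp-≈ (Eq.sym f≈g) Eq.refl)))

  id-iso : ∀ {A} → Iso (id {A})
  id-iso = record { inv = id ; isoˡ = identityˡ ; isoʳ = identityˡ }

  -- A monic coequalizer of (p, q) forces p ≈ q, so id factors through it.
  Mono∧RegularEpi⇒Iso : ∀ {X Y} (f : X ⇒ Y) → Mono f → RegularEpi f → Iso f
  Mono∧RegularEpi⇒Iso {X} {Y} f f-mono (_ , p , q , coeq) = record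
    { inv  = inv
    ; isoˡ = inv∘f≈id
    ; isoʳ = Eq.trans (unique (f ∘ inv) f∘inv∘f≈f) (Eq.sym (unique id identityˡ))
    }
    where
      open IsCoequalizer coeq

      id∘p≈id∘q : id ∘ p ≈ id ∘ q
      id∘p≈id∘q = ∘-resp-≈ Eq.refl (f-mono p q equality)

      inv : Y ⇒ X
      inv = proj₁ (universal id id∘p≈id∘q)

      inv∘f≈id : inv ∘ f ≈ id
      inv∘f≈id = proj₁ (proj₂ (universal id id∘p≈id∘q))

      unique : ∀ (v : Y ⇒ Y) → v ∘ f ≈ f → v ≈ proj₁ (universal f equality)
      unique = proj₂ (proj₂ (universal f equality))

      f∘inv∘f≈f : (f ∘ inv) ∘ f ≈ f
      f∘inv∘f≈f = Eq.trans assoc (Eq.trans (∘-resp-≈ Eq.refl inv∘f≈id) identityʳ)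

module _ {oa ℓa ea oc ℓc ec}
         {𝒜 : Category oa ℓa ea} {𝒞 : Category oc ℓc ec} (F : Functor 𝒜 𝒞) where
  private
    module A = Category 𝒜
    module C = Category 𝒞
  open Functor F

  Faithful⇒reflects-Mono : Faithful F → ∀ {X Y} (f : X A.⇒ Y) → C.Mono (F₁ f) → A.Mono f
  Faithful⇒reflects-Mono faithful f Ff-mono g h f∘g≈f∘h = faithful g h (Ff-mono (F₁ g) (F₁ h) (begin
    F₁ f C.∘ F₁ g  ≈⟨ C.Eq.sym homomorphism ⟩
    F₁ (f A.∘ g)   ≈⟨ F-resp-≈ f∘g≈f∘h ⟩
    F₁ (f A.∘ h)   ≈⟨ homomorphism ⟩
    F₁ f C.∘ F₁ h  ∎))
    where open SetoidR (C.hom-setoid _ _)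

module _ {oa ℓa ea ob ℓb eb oc ℓc ec}
         {𝒜 : Category oa ℓa ea} {ℬ : Category ob ℓb eb} {𝒞 : Category oc ℓc ec}
         (F : Functor 𝒜 𝒞) (G : Functor ℬ 𝒞) where
  private
    module A = Category 𝒜
    module B = Category ℬ
    module C = Category 𝒞
    module F = Functor F
    module G = Functor G
  open CommaObj
  open CommaHom

  Comma-iso : ∀ {X Y} (h : CommaHom F G X Y) →
              Category.Iso 𝒜 (φ h) → Category.Iso ℬ (ψ h) →
              Category.Iso (Comma F G) h
  Comma-iso {X} {Y} h φ-iso ψ-iso = record
    { inv  = commaHom φ⁻¹ ψ⁻¹ inv-commute
    ; isoˡ = φ.isoˡ , ψ.isoˡ
    ; isoʳ = φ.isoʳ , ψ.isoʳ
    }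
    where
      module φ = Category.Iso φ-iso
      module ψ = Category.Iso ψ-iso
      φ⁻¹ : src Y A.⇒ src X
      φ⁻¹ = φ.inv

      ψ⁻¹ : tgt Y B.⇒ tgt X
      ψ⁻¹ = ψ.inv

      open SetoidR (C.hom-setoid _ _)

      F-cancel : F.F₁ (φ h) C.∘ F.F₁ φ⁻¹ C.≈ C.id
      F-cancel = C.Eq.trans (C.Eq.sym F.homomorphism) (C.Eq.trans (F.F-resp-≈ φ.isoʳ) F.identity)

      G-cancel : G.F₁ ψ⁻¹ C.∘ G.F₁ (ψ h) C.≈ C.id
      G-cancel = C.Eq.trans (C.Eq.sym G.homomorphism) (C.Eq.trans (G.F-resp-≈ ψ.isoˡ) G.identity)

      inv-commute : arr X C.∘ F.F₁ φ⁻¹ C.≈ G.F₁ ψ⁻¹ C.∘ arr Y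
      inv-commute = begin
        arr X C.∘ F.F₁ φ⁻¹                                       ≈⟨ C.Eq.sym C.identityˡ ⟩
        C.id C.∘ (arr X C.∘ F.F₁ φ⁻¹)                            ≈⟨ C.∘-resp-≈ (C.Eq.sym G-cancel) C.Eq.refl ⟩
        (G.F₁ ψ⁻¹ C.∘ G.F₁ (ψ h)) C.∘ (arr X C.∘ F.F₁ φ⁻¹)       ≈⟨ C.assoc ⟩
        G.F₁ ψ⁻¹ C.∘ (G.F₁ (ψ h) C.∘ (arr X C.∘ F.F₁ φ⁻¹))       ≈⟨ C.∘-resp-≈ C.Eq.refl (C.Eq.sym C.assoc) ⟩
        G.F₁ ψ⁻¹ C.∘ ((G.F₁ (ψ h) C.∘ arr X) C.∘ F.F₁ φ⁻¹)       ≈⟨ C.∘-resp-≈ C.Eq.refl (C.∘-resp-≈ (C.Eq.sym (commute h)) C.Eq.refl) ⟩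
        G.F₁ ψ⁻¹ C.∘ ((arr Y C.∘ F.F₁ (φ h)) C.∘ F.F₁ φ⁻¹)       ≈⟨ C.∘-resp-≈ C.Eq.refl C.assoc ⟩
        G.F₁ ψ⁻¹ C.∘ (arr Y C.∘ (F.F₁ (φ h) C.∘ F.F₁ φ⁻¹))       ≈⟨ C.∘-resp-≈ C.Eq.refl (C.∘-resp-≈ C.Eq.refl F-cancel) ⟩
        G.F₁ ψ⁻¹ C.∘ (arr Y C.∘ C.id)                            ≈⟨ C.∘-resp-≈ C.Eq.refl C.identityʳ ⟩
        G.F₁ ψ⁻¹ C.∘ arr Y                                       ∎

mainTheorem4 : ∀ {oa ℓa ea ob ℓb eb oc ℓc ec : Level}
    {𝒜 : Category oa ℓa ea} {ℬ : Category ob ℓb eb} {𝒞 : Category oc ℓc ec}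
    (F : Functor 𝒜 𝒞) (G : Functor ℬ 𝒞) →
    Category.IsRegular 𝒜 →
    Faithful F →
    (adj : RightAdjoint F) →
    (X : CommaObj F G) →
    {Ran : Category.Obj 𝒜}
    (e : Category._⇒_ 𝒜 (CommaObj.src X) Ran)
    (m : Category._⇒_ 𝒜 Ran (Functor.F₀ (RightAdjoint.F⋆ adj) (Functor.F₀ G (CommaObj.tgt X)))) →
    Category.RegularEpi 𝒜 e →
    Category.Mono 𝒜 m →
    (fac : Category._≈_ 𝒜 (Category._∘_ 𝒜 m e) (hatArr F G adj X)) →
    Simple F G X →
    Category.Iso (Comma F G) (eta F G adj X e m fac)
mainTheorem4 {𝒜 = 𝒜} {ℬ} {𝒞} F G _ faithful adj X e m e-regular _ fac simple =
  Comma-iso F G η (Mono∧RegularEpi⇒Iso 𝒜 e e-mono e-regular) (id-iso ℬ)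
  where
    open Category 𝒞 using (module Eq; _≈_; _∘_; identityˡ; ∘-resp-≈; Mono)
    η : CommaHom F G X (etaTarget F G adj X m)
    η = eta F G adj X e m fac


    G[id]∘f≈f : Functor.F₁ G (Category.id ℬ) ∘ CommaObj.arr X ≈ CommaObj.arr X
    G[id]∘f≈f = Eq.trans (∘-resp-≈ (Functor.identity G) Eq.refl) identityˡ

    θ∘F[m]∘F[e]-mono : Mono (CommaObj.arr (etaTarget F G adj X m) ∘ Functor.F₁ F e)
    θ∘F[m]∘F[e]-mono = Mono-resp-≈ 𝒞 (Eq.sym (Eq.trans (CommaHom.commute η) G[id]∘f≈f)) simple

    e-mono : Category.Mono 𝒜 e
    e-mono = Faithful⇒reflects-Mono F faithful e (Mono-cancelʳ 𝒞 _ _ θ∘F[m]∘F[e]-mono)
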